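{- Let $T$ be a $3$-graph which is a tree, and let $\tilde T$ denote $T$ together with a choice, for every edge $e\in E(T)$, of a $3$-cycle $\sigma(e)$ on $v(e)$ (an orientation of $e$). For an ordering of $E(T)$, the product $\prod_{e\in E(T)}\sigma(e)$ is a cyclic permutation of $V(T)$, and since $|V(T)|$ is odd it determines an orientation of $V(T)$. Then this orientation, denoted $\mathfrak o(\tilde T)$, does not depend on the chosen ordering of $E(T)$; moreover, $\mathfrak o(\tilde T)$ is replaced by its opposite whenever the orientation of one edge in $\tilde T$ is reversed (i.e. $\sigma(e)$ is replaced by $\sigma(e)^{ -1}$ for one edge $e$).
   Context: A $3$-graph is $G=(V,E,v)$ with $V,E$ finite sets and $v$ a map from $E$ to the set of three-element subsets of $V$. Its topological realization $|G|$ is the graph with a vertex for each element of $V\cup E$ and an edge joining $x\in V$ to $e\in E$ whenever $x\in v(e)$; $G$ is a tree if $|G|$ is connected and simply connected. An orientation of a finite set is an ordering of it up to even permutations. A cyclic permutation $(s_1 s_2\dots s_k)$ of a set with $k$ odd elements determines the orientation given by the ordering $s_1,\dots,s_k$ (well defined since a $k$-cycle is even for $k$ odd). A tree with $n$ edges has $2n+1$ vertices, and the product of the $\sigma(e)$ in any order is a cyclic permutation of $V(T)$. -}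

module Defs where

open import Data.Nat using (ℕ; zero; suc; _≤_)
open import Data.Nat.Divisibility using (_∣_)
open import Data.Fin using (Fin; toℕ; _<?_)
open import Data.Fin.Subset using (Subset; _∈_; _∉_; ∣_∣)
open import Data.Fin.Permutation using (Permutation′; _⟨$⟩ʳ_; _⟨$⟩ˡ_; _∘ₚ_; flip; id)
open import Data.List using (List; []; _∷_; _++_; length; filter; allFin; cartesianProduct; map)
open import Data.List.Relation.Unary.Unique.Propositional using (Unique)
open import Data.List.Relation.Unary.Linked using (Linked)
open import Data.Product using (Σ; ∃; _×_; _,_; proj₁; proj₂)
open import Data.Sum using (_⊎_; inj₁; inj₂)
open import Data.Empty using (⊥)
open import Relation.Binary.PropositionalEquality using (_≡_; _≢_)
open import Relation.Nullary using (¬_)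
open import Relation.Nullary.Decidable using (_×-dec_)

record ThreeGraph (m n : ℕ) : Set where
  field
    v       : Fin n → Subset m
    v-three : ∀ e → ∣ v e ∣ ≡ 3
open ThreeGraph public

-- vertices of the topological realization |G|
Node : ℕ → ℕ → Set
Node m n = Fin m ⊎ Fin n

Adj : ∀ {m n} → ThreeGraph m n → Node m n → Node m n → Set
Adj G (inj₁ x) (inj₂ e) = x ∈ v G e
Adj G (inj₂ e) (inj₁ x) = x ∈ v G e
Adj G (inj₁ _) (inj₁ _) = ⊥
Adj G (inj₂ _) (inj₂ _) = ⊥

data Walk {m n} (G : ThreeGraph m n) : Node m n → Node m n → Set where
  here : ∀ {a} → Walk G a a
  step : ∀ {a b c} → Adj G a b → Walk G b c → Walk G a c

Connected : ∀ {m n} → ThreeGraph m n → Set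
Connected G = ∀ a b → Walk G a b

HasCycle : ∀ {m n} → ThreeGraph m n → Set
HasCycle {m} {n} G =
  Σ (Node m n) λ x → Σ (List (Node m n)) λ xs →
    (3 ≤ length (x ∷ xs)) × Unique (x ∷ xs) × Linked (Adj G) (x ∷ xs ++ x ∷ [])

-- a graph is simply connected (as a 1-dim complex) iff it has no cycle
IsTree : ∀ {m n} → ThreeGraph m n → Set
IsTree G = Connected G × ¬ HasCycle G

Perm : ℕ → Set
Perm m = Permutation′ m

IsThreeCycleOn : ∀ {m} → Subset m → Perm m → Set
IsThreeCycleOn {m} s π =
  Σ (Fin m) λ a → Σ (Fin m) λ b → Σ (Fin m) λ c →
    a ≢ b × b ≢ c × a ≢ c × a ∈ s × b ∈ s × c ∈ s ×
    π ⟨$⟩ʳ a ≡ b × π ⟨$⟩ʳ b ≡ c × π ⟨$⟩ʳ c ≡ a ×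
    (∀ x → x ∉ s → π ⟨$⟩ʳ x ≡ x)

EdgeOrientation : ∀ {m n} → ThreeGraph m n → Set
EdgeOrientation {m} {n} G = Σ (Fin n → Perm m) λ σ → ∀ e → IsThreeCycleOn (v G e) (σ e)

prod : ∀ {m} → List (Perm m) → Perm m
prod []       = id
prod (π ∷ πs) = prod πs ∘ₚ π   -- (prod (π ∷ πs)) x = π (prod πs x)

-- an ordering of E(T) is a bijection ρ : Fin n → E, ρ i = i-th edge;
-- product σ(ρ 0) σ(ρ 1) ⋯ σ(ρ (n-1))
productAlong : ∀ {m n} → (Fin n → Perm m) → Perm n → Perm m
productAlong {n = n} σ ρ = prod (map (λ i → σ (ρ ⟨$⟩ʳ i)) (allFin n))

reverseAt : ∀ {m n} → (Fin n → Perm m) → Fin n → Fin n → Perm m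
reverseAt σ e₀ e with e Data.Fin.≟ e₀
... | Relation.Nullary.yes _ = flip (σ e)
... | Relation.Nullary.no  _ = σ e

-- an ordering of V = Fin m is a bijection o : Fin m → V (o i = i-th element)
Ordering : ℕ → Set
Ordering m = Permutation′ m

-- the ordering o is s₁, c s₁, c² s₁, …, i.e. c is the cyclic permutation
-- (o 0  o 1  …  o (m-1))
CycleOrdering : ∀ {m} → Perm m → Ordering m → Set
CycleOrdering {m} c o =
  ∀ (i j : Fin m) → (suc (toℕ i) ≡ toℕ j) ⊎ (suc (toℕ i) ≡ m × toℕ j ≡ 0) →
    c ⟨$⟩ʳ (o ⟨$⟩ʳ i) ≡ o ⟨$⟩ʳ j

inversions : ∀ {m} → (Fin m → Fin m) → ℕ
inversions {m} p =
  length (filter (λ ij → (proj₁ ij <? proj₂ ij) ×-dec (p (proj₂ ij) <? p (proj₁ ij)))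
                 (cartesianProduct (allFin m) (allFin m)))

IsEven : ∀ {m} → Perm m → Set
IsEven π = 2 ∣ inversions (π ⟨$⟩ʳ_)

-- two orderings define the same orientation iff they differ by an even
-- permutation: o' = o ∘ p with p even
SameOrientation : ∀ {m} → Ordering m → Ordering m → Set
SameOrientation o o' = IsEven (o' ∘ₚ flip o)

-- Attach the edges of T one at a time, starting from a vertex r, so that each new edge e
-- meets the part built so far in one vertex a; if σ(e) = (a b c), list the new vertices as b, c.
-- This gives a list r b₁ c₁ b₂ c₂ … of V(T).  For any ordering of E(T), inserting the factor
-- σ(e) = (a b c) into the product of the others splices b, c into its cycle right after the
-- preimage of a, so by induction the product is a single cycle, and its entries arise from
-- r b₁ c₁ … by rotations and by moving blocks of two.  As |V(T)| is odd, neither changes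
-- the parity of the number of inversions, so every cycle ordering has the orientation of
-- r b₁ c₁ …; reversing σ(e) for one edge exchanges one pair bᵢ cᵢ, which flips it.
module Submission where

open import Defs
open import Data.Bool.Base using (Bool; true; false; _∧_)
open import Data.Empty using (⊥; ⊥-elim)
open import Data.Fin using (Fin; zero; suc; toℕ; fromℕ; cast; _<_; _<?_; _≟_)
import Data.Fin.Properties as Fin
open import Data.Fin.Permutation using (_⟨$⟩ʳ_; _⟨$⟩ˡ_; _∘ₚ_; flip; inverseˡ; inverseʳ; permutation)
import Data.Fin.Permutation as Permutation
open import Data.Fin.Subset using (Subset; ⊤; ∣_∣) renaming (_∈_ to _∈ₛ_)
open import Data.Fin.Subset.Properties using (x∈p⇒∣p-x∣<∣p∣; x∈p∧x≢y⇒x∈p-y; ∈⊤; ∣⊤∣≡n)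
open import Data.List.Base as List using (List; []; _∷_; _++_; [_]; length; map; filter; foldr; tabulate; allFin; cartesianProduct; lookup)
import Data.List.Properties as List
open import Data.List.Membership.Propositional using (_∈_; _∉_)
open import Data.List.Membership.Propositional.Properties using (∈-∃++; ∈-++⁺ˡ; ∈-++⁺ʳ; ∈-++⁻; ∈-lookup; ∈-tabulate⁺; ∈-allFin)
open import Data.List.Membership.Propositional.Properties.WithK using (unique∧set⇒bag)
import Data.List.Membership.DecPropositional as DecMembership
open import Data.List.Relation.Binary.BagAndSetEquality using (∼bag⇒↭)
open import Data.List.Relation.Binary.Disjoint.Propositional using (Disjoint)
open import Data.List.Relation.Binary.Permutation.Propositional using (_↭_; prep; swap; ↭-sym; ↭⇒↭ₛ) renaming (refl to ↭-refl; trans to ↭-trans)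
import Data.List.Relation.Binary.Permutation.Propositional.Properties as ↭
import Data.List.Relation.Binary.Permutation.Setoid.Properties as ↭ₛ
open import Data.List.Relation.Unary.All as All using (All; []; _∷_)
import Data.List.Relation.Unary.All.Properties as All
open import Data.List.Relation.Unary.AllPairs using (AllPairs; []; _∷_)
import Data.List.Relation.Unary.AllPairs.Properties as AllPairs
open import Data.List.Relation.Unary.Any using (here; there; index)
open import Data.List.Relation.Unary.Any.Properties using (lookup-index)
open import Data.List.Relation.Unary.Linked as Linked using (Linked; []; [-]; _∷_)
open import Data.List.Relation.Unary.Unique.Propositional using (Unique)
import Data.List.Relation.Unary.Unique.Propositional.Properties as Unique
open import Data.Nat.Base as ℕ using (ℕ; zero; suc; _≤_; z≤n; s≤s; parity)
import Data.Nat.Properties as ℕ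
open import Data.Nat.Divisibility using (_∣_; divides)
open import Data.Parity.Base using (Parity; 0ℙ; 1ℙ; _+_; _*_)
import Data.Parity.Properties as ℙ
open import Algebra.Solver.CommutativeMonoid ℙ.+-0-commutativeMonoid using (solve; _⊜_; _⊕_)
open import Data.Product.Base using (∃; _×_; _,_; proj₁; proj₂)
open import Data.Sum.Base using (_⊎_; inj₁; inj₂; [_,_]′)
import Data.Sum.Properties as Sum
open import Data.Vec.Base using ([])
open import Function.Base using (_∘_; id)
open import Function.Bundles using (_⇔_; mk⇔; Injection; Equivalence)
open import Function.Definitions using (Injective)
open import Function.Properties.Inverse using (↔⇒↣)
open import Relation.Binary.Definitions using (tri<; tri≈; tri>)
open import Relation.Binary.PropositionalEquality hiding ([_])
open import Relation.Nullary.Decidable using (Dec; does; yes; no; dec-true; dec-false)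
open import Relation.Nullary.Negation using (¬_; contradiction)
open import Relation.Unary using (Decidable)

private
  variable
    A B : Set
    m : ℕ

Σℙ : (A → Parity) → List A → Parity
Σℙ f xs = foldr _+_ 0ℙ (map f xs)

ℙ[_] : Bool → Parity
ℙ[ true ]  = 1ℙ
ℙ[ false ] = 0ℙ

Σℙ-++ : ∀ (f : A → Parity) xs ys → Σℙ f (xs ++ ys) ≡ Σℙ f xs + Σℙ f ys
Σℙ-++ f []       ys = refl
Σℙ-++ f (x ∷ xs) ys = trans (cong (f x +_) (Σℙ-++ f xs ys)) (sym (ℙ.+-assoc (f x) _ _))

Σℙ-↭ : ∀ (f : A → Parity) {xs ys} → xs ↭ ys → Σℙ f xs ≡ Σℙ f ys
Σℙ-↭ f p = ↭ₛ.foldr-commMonoid (setoid Parity) ℙ.+-0-isCommutativeMonoid (↭⇒↭ₛ (↭.map⁺ f p))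

Σℙ-map : ∀ (f : B → Parity) (g : A → B) xs → Σℙ f (map g xs) ≡ Σℙ (f ∘ g) xs
Σℙ-map f g xs = cong (foldr _+_ 0ℙ) (sym (List.map-∘ xs))

Σℙ-congᴬ : ∀ {f g : A → Parity} {xs} → All (λ x → f x ≡ g x) xs → Σℙ f xs ≡ Σℙ g xs
Σℙ-congᴬ []         = refl
Σℙ-congᴬ (eq ∷ eqs) = cong₂ _+_ eq (Σℙ-congᴬ eqs)

Σℙ-cong : ∀ {f g : A → Parity} → (∀ x → f x ≡ g x) → ∀ xs → Σℙ f xs ≡ Σℙ g xs
Σℙ-cong eq xs = Σℙ-congᴬ (All.tabulate {xs = xs} (λ {x} _ → eq x))

Σℙ-+ : ∀ (f g : A → Parity) xs → Σℙ (λ x → f x + g x) xs ≡ Σℙ f xs + Σℙ g xs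
Σℙ-+ f g []       = refl
Σℙ-+ f g (x ∷ xs) = trans (cong (f x + g x +_) (Σℙ-+ f g xs))
  (solve 4 (λ a b c d → (a ⊕ b) ⊕ (c ⊕ d) ⊜ (a ⊕ c) ⊕ (b ⊕ d)) refl (f x) (g x) (Σℙ f xs) (Σℙ g xs))

Σℙ-const : ∀ p (xs : List A) → Σℙ (λ _ → p) xs ≡ parity (length xs) * p
Σℙ-const p []       = refl
Σℙ-const p (x ∷ xs) = begin
  p + Σℙ (λ _ → p) xs                 ≡⟨ cong (p +_) (Σℙ-const p xs) ⟩
  p + (parity (length xs) * p)        ≡⟨ p+qp≡[1+q]p (parity (length xs)) p ⟩
  (1ℙ + parity (length xs)) * p       ≡⟨ cong (_* p) (sym (ℙ.+-homo-+ 1 (length xs))) ⟩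
  parity (suc (length xs)) * p        ∎
  where
  open ≡-Reasoning
  p+qp≡[1+q]p : ∀ q p → p + (q * p) ≡ (1ℙ + q) * p
  p+qp≡[1+q]p 0ℙ p = ℙ.+-identityʳ p
  p+qp≡[1+q]p 1ℙ p = ℙ.p+p≡0ℙ p

Σℙ-comm : ∀ (f : A → B → Parity) xs ys →
          Σℙ (λ x → Σℙ (f x) ys) xs ≡ Σℙ (λ y → Σℙ (λ x → f x y) xs) ys
Σℙ-comm f []       ys = sym (trans (Σℙ-const 0ℙ ys) (ℙ.*-zeroʳ _))
Σℙ-comm f (x ∷ xs) ys =
  trans (cong (Σℙ (f x) ys +_) (Σℙ-comm f xs ys)) (sym (Σℙ-+ (f x) _ ys))

Σℙ-cartesianProduct : ∀ (f : A × B → Parity) xs ys →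
                      Σℙ f (cartesianProduct xs ys) ≡ Σℙ (λ x → Σℙ (λ y → f (x , y)) ys) xs
Σℙ-cartesianProduct f []       ys = refl
Σℙ-cartesianProduct f (x ∷ xs) ys = begin
  Σℙ f (map (x ,_) ys ++ cartesianProduct xs ys)
    ≡⟨ Σℙ-++ f (map (x ,_) ys) _ ⟩
  Σℙ f (map (x ,_) ys) + Σℙ f (cartesianProduct xs ys)
    ≡⟨ cong₂ _+_ (Σℙ-map f (x ,_) ys) (Σℙ-cartesianProduct f xs ys) ⟩
  Σℙ (λ y → f (x , y)) ys + Σℙ (λ x → Σℙ (λ y → f (x , y)) ys) xs ∎
  where open ≡-Reasoning

Σℙ-zero : ∀ {A : Set} {f : A → Parity} {xs} → All (λ x → f x ≡ 0ℙ) xs → Σℙ f xs ≡ 0ℙ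
Σℙ-zero {xs = xs} zeros = trans (Σℙ-congᴬ zeros) (trans (Σℙ-const 0ℙ xs) (ℙ.*-zeroʳ _))

parity-length-filter : ∀ {P : A → Set} (P? : Decidable P) xs →
                       parity (length (filter P? xs)) ≡ Σℙ (λ x → ℙ[ does (P? x) ]) xs
parity-length-filter P? [] = refl
parity-length-filter P? (x ∷ xs) with does (P? x)
... | true  = trans (ℙ.+-homo-+ 1 (length (filter P? xs))) (cong (1ℙ +_) (parity-length-filter P? xs))
... | false = parity-length-filter P? xs

2∣⇔parity≡0ℙ : ∀ k → 2 ∣ k ⇔ parity k ≡ 0ℙ
2∣⇔parity≡0ℙ k = mk⇔ to (from k)
  where
  to : ∀ {k} → 2 ∣ k → parity k ≡ 0ℙ
  to (divides q refl) = trans (ℙ.*-homo-* q 2) (ℙ.*-zeroʳ (parity q))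
  from : ∀ k → parity k ≡ 0ℙ → 2 ∣ k
  from zero          _  = divides 0 refl
  from (suc (suc k)) eq with from k eq
  ... | divides q refl = divides (suc q) refl

+≡0ℙ⇔≡ : ∀ p q → p + q ≡ 0ℙ ⇔ p ≡ q
+≡0ℙ⇔≡ p q = mk⇔ (to p q) (λ { refl → ℙ.p+p≡0ℙ p })
  where
  to : ∀ p q → p + q ≡ 0ℙ → p ≡ q
  to 0ℙ 0ℙ _ = refl
  to 1ℙ 1ℙ _ = refl

p+q≡r⇒q≡p+r : ∀ {p q r} → p + q ≡ r → q ≡ p + r
p+q≡r⇒q≡p+r {0ℙ} refl = refl
p+q≡r⇒q≡p+r {1ℙ} refl = sym (ℙ.⁻¹-involutive _)

Unique-resp-↭ : ∀ {A : Set} {xs ys : List A} → xs ↭ ys → Unique xs → Unique ys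
Unique-resp-↭ {A} p = ↭ₛ.Unique-resp-↭ (setoid A) (↭⇒↭ₛ p)

Unique-++⇒Disjoint : ∀ {A : Set} (xs {ys} : List A) → Unique (xs ++ ys) → Disjoint xs ys
Unique-++⇒Disjoint (x ∷ xs) (x∉ ∷ _) (here refl , v∈ys) = All.lookup (All.++⁻ʳ xs x∉) v∈ys refl
Unique-++⇒Disjoint (x ∷ xs) (_ ∷ u)  (there v∈xs , v∈ys) = Unique-++⇒Disjoint xs u (v∈xs , v∈ys)

unique-complete⇒↭ : ∀ {xs ys : List A} → Unique xs → Unique ys →
                    (∀ x → x ∈ xs) → (∀ x → x ∈ ys) → xs ↭ ys
unique-complete⇒↭ u u′ all all′ =
  ∼bag⇒↭ (unique∧set⇒bag u u′ (λ {x} → mk⇔ (λ _ → all′ x) (λ _ → all x)))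

lookup-injective : ∀ {A : Set} {xs : List A} → Unique xs → ∀ i j → lookup xs i ≡ lookup xs j → i ≡ j
lookup-injective {xs = _ ∷ _}  _       zero    zero    _  = refl
lookup-injective {xs = _ ∷ xs} u       zero    (suc j) eq =
  contradiction (subst (_∈ xs) (sym eq) (∈-lookup j)) (Unique.Unique[x∷xs]⇒x∉xs u)
lookup-injective {xs = _ ∷ xs} u       (suc i) zero    eq =
  contradiction (subst (_∈ xs) eq (∈-lookup i)) (Unique.Unique[x∷xs]⇒x∉xs u)
lookup-injective {xs = _ ∷ _}  (_ ∷ u) (suc i) (suc j) eq = cong suc (lookup-injective u i j eq)

-- Inversion parity of lists

⟦_<_⟧ : Fin m → Fin m → Parity
⟦ x < y ⟧ = ℙ[ does (x <? y) ]

below : Fin m → List (Fin m) → Parity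
below x ys = Σℙ (λ y → ⟦ y < x ⟧) ys

invParity : List (Fin m) → Parity
invParity []       = 0ℙ
invParity (x ∷ xs) = below x xs + invParity xs

cross : List (Fin m) → List (Fin m) → Parity
cross xs ys = Σℙ (λ x → below x ys) xs

⟦<⟧-true : ∀ {x y : Fin m} → x < y → ⟦ x < y ⟧ ≡ 1ℙ
⟦<⟧-true {x = x} {y} x<y = cong ℙ[_] (dec-true (x <? y) x<y)

⟦<⟧-false : ∀ {x y : Fin m} → y < x → ⟦ x < y ⟧ ≡ 0ℙ
⟦<⟧-false {x = x} {y} y<x = cong ℙ[_] (dec-false (x <? y) (Fin.<-asym y<x))

⟦<⟧-flip : ∀ {x y : Fin m} → x ≢ y → ⟦ y < x ⟧ ≡ 1ℙ + ⟦ x < y ⟧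
⟦<⟧-flip {x = x} {y} x≢y with Fin.<-cmp x y
... | tri< x<y _ _ = trans (⟦<⟧-false x<y) (sym (cong (1ℙ +_) (⟦<⟧-true x<y)))
... | tri≈ _ x≡y _ = contradiction x≡y x≢y
... | tri> _ _ y<x = trans (⟦<⟧-true y<x) (sym (cong (1ℙ +_) (⟦<⟧-false y<x)))

invParity-++ : ∀ (xs ys : List (Fin m)) →
               invParity (xs ++ ys) ≡ invParity xs + invParity ys + cross xs ys
invParity-++ []       ys = sym (ℙ.+-identityʳ (invParity ys))
invParity-++ (x ∷ xs) ys = begin
  below x (xs ++ ys) + invParity (xs ++ ys)
    ≡⟨ cong₂ _+_ (Σℙ-++ (λ y → ⟦ y < x ⟧) xs ys) (invParity-++ xs ys) ⟩
  below x xs + below x ys + (invParity xs + invParity ys + cross xs ys)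
    ≡⟨ solve 5 (λ a b c d e → (a ⊕ b) ⊕ ((c ⊕ d) ⊕ e) ⊜ ((a ⊕ c) ⊕ d) ⊕ (b ⊕ e)) refl
         (below x xs) (below x ys) (invParity xs) (invParity ys) (cross xs ys) ⟩
  below x xs + invParity xs + invParity ys + (below x ys + cross xs ys) ∎
  where open ≡-Reasoning

cross-+-cross : ∀ {xs ys : List (Fin m)} → Disjoint xs ys →
                cross xs ys + cross ys xs ≡ parity (length xs ℕ.* length ys)
cross-+-cross {xs = xs} {ys} xs#ys = begin
  cross xs ys + cross ys xs
    ≡⟨ cong (cross xs ys +_) (Σℙ-comm (λ y x → ⟦ x < y ⟧) ys xs) ⟩
  Σℙ (λ x → below x ys) xs + Σℙ (λ x → Σℙ (λ y → ⟦ x < y ⟧) ys) xs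
    ≡⟨ sym (Σℙ-+ (λ x → below x ys) _ xs) ⟩
  Σℙ (λ x → below x ys + Σℙ (λ y → ⟦ x < y ⟧) ys) xs
    ≡⟨ Σℙ-congᴬ (All.tabulate row) ⟩
  Σℙ (λ _ → parity (length ys)) xs
    ≡⟨ Σℙ-const (parity (length ys)) xs ⟩
  parity (length xs) * parity (length ys)
    ≡⟨ sym (ℙ.*-homo-* (length xs) (length ys)) ⟩
  parity (length xs ℕ.* length ys) ∎
  where
  open ≡-Reasoning
  row : ∀ {x} → x ∈ xs → below x ys + Σℙ (λ y → ⟦ x < y ⟧) ys ≡ parity (length ys)
  row {x} x∈xs = begin
    below x ys + Σℙ (λ y → ⟦ x < y ⟧) ys      ≡⟨ sym (Σℙ-+ (λ y → ⟦ y < x ⟧) _ ys) ⟩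
    Σℙ (λ y → ⟦ y < x ⟧ + ⟦ x < y ⟧) ys       ≡⟨ Σℙ-congᴬ (All.tabulate pair) ⟩
    Σℙ (λ _ → 1ℙ) ys                          ≡⟨ Σℙ-const 1ℙ ys ⟩
    parity (length ys) * 1ℙ                    ≡⟨ ℙ.*-identityʳ _ ⟩
    parity (length ys)                         ∎
    where
    pair : ∀ {y} → y ∈ ys → ⟦ y < x ⟧ + ⟦ x < y ⟧ ≡ 1ℙ
    pair {y} y∈ys = begin
      ⟦ y < x ⟧ + ⟦ x < y ⟧          ≡⟨ cong (_+ ⟦ x < y ⟧) (⟦<⟧-flip {x = x} (λ { refl → xs#ys (x∈xs , y∈ys) })) ⟩
      1ℙ + ⟦ x < y ⟧ + ⟦ x < y ⟧     ≡⟨ ℙ.+-assoc 1ℙ ⟦ x < y ⟧ ⟦ x < y ⟧ ⟩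
      1ℙ + (⟦ x < y ⟧ + ⟦ x < y ⟧)   ≡⟨ cong (1ℙ +_) (ℙ.p+p≡0ℙ ⟦ x < y ⟧) ⟩
      1ℙ                             ∎

invParity-++-comm : ∀ {xs ys : List (Fin m)} → Disjoint xs ys →
                    invParity (ys ++ xs) ≡ invParity (xs ++ ys) + parity (length xs ℕ.* length ys)
invParity-++-comm {xs = xs} {ys} xs#ys = begin
  invParity (ys ++ xs)
    ≡⟨ invParity-++ ys xs ⟩
  invParity ys + invParity xs + cross ys xs
    ≡⟨ cong (invParity ys + invParity xs +_) (p+q≡r⇒q≡p+r {cross xs ys} (cross-+-cross xs#ys)) ⟩
  invParity ys + invParity xs + (cross xs ys + N)
    ≡⟨ solve 4 (λ a b c d → (b ⊕ a) ⊕ (c ⊕ d) ⊜ ((a ⊕ b) ⊕ c) ⊕ d) refl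
         (invParity xs) (invParity ys) (cross xs ys) N ⟩
  invParity xs + invParity ys + cross xs ys + N
    ≡⟨ cong (_+ N) (sym (invParity-++ xs ys)) ⟩
  invParity (xs ++ ys) + N ∎
  where
  open ≡-Reasoning
  N = parity (length xs ℕ.* length ys)

invParity-rotate : ∀ (xs ys : List (Fin m)) → Unique (xs ++ ys) → parity (length (xs ++ ys)) ≡ 1ℙ →
                   invParity (ys ++ xs) ≡ invParity (xs ++ ys)
invParity-rotate xs ys u odd = begin
  invParity (ys ++ xs)                                    ≡⟨ invParity-++-comm (Unique-++⇒Disjoint xs u) ⟩
  invParity (xs ++ ys) + parity (length xs ℕ.* length ys)  ≡⟨ cong (invParity (xs ++ ys) +_) even-product ⟩
  invParity (xs ++ ys) + 0ℙ                               ≡⟨ ℙ.+-identityʳ _ ⟩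
  invParity (xs ++ ys)                                    ∎
  where
  open ≡-Reasoning
  one-even : ∀ p q → p + q ≡ 1ℙ → p * q ≡ 0ℙ
  one-even 0ℙ q  _ = refl
  one-even 1ℙ 0ℙ _ = refl
  even-product : parity (length xs ℕ.* length ys) ≡ 0ℙ
  even-product = trans (ℙ.*-homo-* (length xs) (length ys)) (one-even (parity (length xs)) (parity (length ys))
    (trans (sym (ℙ.+-homo-+ (length xs) (length ys))) (trans (cong parity (sym (List.length-++ xs))) odd)))

invParity-moveBlock : ∀ {b c : Fin m} zs → b ∉ zs → c ∉ zs → invParity (b ∷ c ∷ zs) ≡ invParity (zs ++ b ∷ c ∷ [])
invParity-moveBlock {b = b} {c} zs b∉ c∉ = sym (begin
  invParity (zs ++ b ∷ c ∷ [])                        ≡⟨ invParity-++-comm disjoint ⟩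
  invParity (b ∷ c ∷ zs) + parity (2 ℕ.* length zs)   ≡⟨ cong (invParity (b ∷ c ∷ zs) +_) (ℙ.*-homo-* 2 (length zs)) ⟩
  invParity (b ∷ c ∷ zs) + 0ℙ                         ≡⟨ ℙ.+-identityʳ _ ⟩
  invParity (b ∷ c ∷ zs)                              ∎)
  where
  open ≡-Reasoning
  disjoint : Disjoint (b ∷ c ∷ []) zs
  disjoint (here refl         , x∈) = b∉ x∈
  disjoint (there (here refl) , x∈) = c∉ x∈

invParity-swap : ∀ {x y : Fin m} zs → x ≢ y → invParity (x ∷ y ∷ zs) ≡ 1ℙ + invParity (y ∷ x ∷ zs)
invParity-swap {x = x} {y} zs x≢y = begin
  ⟦ y < x ⟧ + below x zs + (below y zs + invParity zs)
    ≡⟨ cong (λ p → p + below x zs + (below y zs + invParity zs)) (⟦<⟧-flip x≢y) ⟩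
  1ℙ + ⟦ x < y ⟧ + below x zs + (below y zs + invParity zs)
    ≡⟨ solve 5 (λ o a b c d → ((o ⊕ a) ⊕ b) ⊕ (c ⊕ d) ⊜ o ⊕ ((a ⊕ c) ⊕ (b ⊕ d))) refl
         1ℙ ⟦ x < y ⟧ (below x zs) (below y zs) (invParity zs) ⟩
  1ℙ + (⟦ x < y ⟧ + below y zs + (below x zs + invParity zs)) ∎
  where open ≡-Reasoning

invParity-swap-last : ∀ {b c : Fin m} xs → b ≢ c → invParity (xs ++ c ∷ b ∷ []) ≡ 1ℙ + invParity (xs ++ b ∷ c ∷ [])
invParity-swap-last {b = b} {c} xs b≢c = begin
  invParity (xs ++ c ∷ b ∷ [])
    ≡⟨ invParity-++ xs (c ∷ b ∷ []) ⟩
  invParity xs + invParity (c ∷ b ∷ []) + cross xs (c ∷ b ∷ [])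
    ≡⟨ cong₂ (λ a d → invParity xs + a + d) (invParity-swap [] (b≢c ∘ sym))
             (Σℙ-cong (λ x → Σℙ-↭ (λ y → ⟦ y < x ⟧) (swap c b (↭-refl {xs = []}))) xs) ⟩
  invParity xs + (1ℙ + invParity (b ∷ c ∷ [])) + cross xs (b ∷ c ∷ [])
    ≡⟨ solve 4 (λ o a d e → (a ⊕ (o ⊕ d)) ⊕ e ⊜ o ⊕ ((a ⊕ d) ⊕ e)) refl
         1ℙ (invParity xs) (invParity (b ∷ c ∷ [])) (cross xs (b ∷ c ∷ [])) ⟩
  1ℙ + (invParity xs + invParity (b ∷ c ∷ []) + cross xs (b ∷ c ∷ []))
    ≡⟨ cong (1ℙ +_) (sym (invParity-++ xs (b ∷ c ∷ []))) ⟩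
  1ℙ + invParity (xs ++ b ∷ c ∷ []) ∎
  where open ≡-Reasoning

invParity-++-↭ : ∀ {xs ys : List (Fin m)} {p} zs → xs ↭ ys → invParity xs ≡ p + invParity ys →
                 invParity (xs ++ zs) ≡ p + invParity (ys ++ zs)
invParity-++-↭ {xs = xs} {ys} {p} zs xs↭ys eq = begin
  invParity (xs ++ zs)                               ≡⟨ invParity-++ xs zs ⟩
  invParity xs + invParity zs + cross xs zs          ≡⟨ cong₂ (λ a b → a + invParity zs + b) eq (Σℙ-↭ (λ x → below x zs) xs↭ys) ⟩
  p + invParity ys + invParity zs + cross ys zs      ≡⟨ solve 4 (λ p a b c → ((p ⊕ a) ⊕ b) ⊕ c ⊜ p ⊕ ((a ⊕ b) ⊕ c)) refl
                                                          p (invParity ys) (invParity zs) (cross ys zs) ⟩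
  p + (invParity ys + invParity zs + cross ys zs)    ≡⟨ cong (p +_) (sym (invParity-++ ys zs)) ⟩
  p + invParity (ys ++ zs)                           ∎
  where open ≡-Reasoning

invParity-sorted : ∀ {xs : List (Fin m)} → AllPairs _<_ xs → invParity xs ≡ 0ℙ
invParity-sorted []                 = refl
invParity-sorted (x<xs ∷ sorted) =
  cong₂ _+_ (Σℙ-zero (All.map ⟦<⟧-false x<xs)) (invParity-sorted sorted)

invParity-allFin : ∀ m → invParity (allFin m) ≡ 0ℙ
invParity-allFin m = invParity-sorted {m} (AllPairs.tabulate⁺-< {f = id} id)

parity-inversions : ∀ (p : Fin m → Fin m) → parity (inversions p) ≡ invParity (tabulate p)
parity-inversions {m} p = begin
  parity (inversions p)
    ≡⟨ parity-length-filter _ (cartesianProduct (allFin m) (allFin m)) ⟩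
  Σℙ (λ ij → inverted (proj₁ ij) (proj₂ ij)) (cartesianProduct (allFin m) (allFin m))
    ≡⟨ Σℙ-cartesianProduct _ (allFin m) (allFin m) ⟩
  Σℙ (λ i → Σℙ (inverted i) (allFin m)) (allFin m)
    ≡⟨ sorted-sum (AllPairs.tabulate⁺-< id) ⟩
  invParity (map p (allFin m))
    ≡⟨ cong invParity (List.map-tabulate id p) ⟩
  invParity (tabulate p) ∎
  where
  open ≡-Reasoning
  inverted : Fin m → Fin m → Parity
  inverted i j = ℙ[ does (i <? j) ∧ does (p j <? p i) ]
  inverted-< : ∀ {i j} → i < j → inverted i j ≡ ⟦ p j < p i ⟧
  inverted-< {i} {j} i<j = cong (λ b → ℙ[ b ∧ does (p j <? p i) ]) (dec-true (i <? j) i<j)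
  not-inverted : ∀ {i j} → ¬ i < j → inverted i j ≡ 0ℙ
  not-inverted {i} {j} i≮j = cong (λ b → ℙ[ b ∧ does (p j <? p i) ]) (dec-false (i <? j) i≮j)
  sorted-sum : ∀ {ks} → AllPairs _<_ ks → Σℙ (λ i → Σℙ (inverted i) ks) ks ≡ invParity (map p ks)
  sorted-sum {[]}     []               = refl
  sorted-sum {k ∷ ks} (k<ks ∷ sorted) = begin
    inverted k k + Σℙ (inverted k) ks + Σℙ (λ i → inverted i k + Σℙ (inverted i) ks) ks
      ≡⟨ cong₂ (λ a b → a + Σℙ (inverted k) ks + b) (not-inverted {k} {k} (Fin.<-irrefl refl))
               (Σℙ-+ (λ i → inverted i k) _ ks) ⟩
    Σℙ (inverted k) ks + (Σℙ (λ i → inverted i k) ks + Σℙ (λ i → Σℙ (inverted i) ks) ks)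
      ≡⟨ cong₂ (λ a b → a + (b + Σℙ (λ i → Σℙ (inverted i) ks) ks))
               (trans (Σℙ-congᴬ (All.map inverted-< k<ks)) (sym (Σℙ-map (λ y → ⟦ y < p k ⟧) p ks)))
               (Σℙ-zero (All.map (λ k<i → not-inverted (Fin.<-asym k<i)) k<ks)) ⟩
    below (p k) (map p ks) + Σℙ (λ i → Σℙ (inverted i) ks) ks
      ≡⟨ cong (below (p k) (map p ks) +_) (sorted-sum sorted) ⟩
    below (p k) (map p ks) + invParity (map p ks) ∎

relParity : (Fin m → Fin m) → List (Fin m) → Parity
relParity g xs = invParity (map g xs) + invParity xs

relParity-∷ : ∀ (g : Fin m → Fin m) x {xs ys} → xs ↭ ys →
              relParity g xs ≡ relParity g ys → relParity g (x ∷ xs) ≡ relParity g (x ∷ ys)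
relParity-∷ g x {xs} {ys} p eq = begin
  below (g x) (map g xs) + invParity (map g xs) + (below x xs + invParity xs)
    ≡⟨ regroup xs (below (g x) (map g xs)) (below x xs) ⟩
  below (g x) (map g xs) + below x xs + relParity g xs
    ≡⟨ cong₂ _+_ (cong₂ _+_ (Σℙ-↭ (λ y → ⟦ y < g x ⟧) (↭.map⁺ g p)) (Σℙ-↭ (λ y → ⟦ y < x ⟧) p)) eq ⟩
  below (g x) (map g ys) + below x ys + relParity g ys
    ≡⟨ sym (regroup ys (below (g x) (map g ys)) (below x ys)) ⟩
  below (g x) (map g ys) + invParity (map g ys) + (below x ys + invParity ys) ∎
  where
  open ≡-Reasoning
  regroup : ∀ zs a b → a + invParity (map g zs) + (b + invParity zs) ≡ a + b + relParity g zs
  regroup zs a b = solve 4 (λ a b c d → (a ⊕ c) ⊕ (b ⊕ d) ⊜ (a ⊕ b) ⊕ (c ⊕ d)) refl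
                       a b (invParity (map g zs)) (invParity zs)

relParity-swap : ∀ {g : Fin m → Fin m} → Injective _≡_ _≡_ g → ∀ {x y} zs → x ≢ y →
                 relParity g (x ∷ y ∷ zs) ≡ relParity g (y ∷ x ∷ zs)
relParity-swap {g = g} g-inj {x} {y} zs x≢y = begin
  relParity g (x ∷ y ∷ zs)
    ≡⟨ cong₂ _+_ (invParity-swap (map g zs) (x≢y ∘ g-inj)) (invParity-swap zs x≢y) ⟩
  1ℙ + invParity (map g (y ∷ x ∷ zs)) + (1ℙ + invParity (y ∷ x ∷ zs))
    ≡⟨ flips-cancel (invParity (map g (y ∷ x ∷ zs))) (invParity (y ∷ x ∷ zs)) ⟩
  relParity g (y ∷ x ∷ zs) ∎
  where
  open ≡-Reasoning
  flips-cancel : ∀ a b → 1ℙ + a + (1ℙ + b) ≡ a + b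
  flips-cancel 0ℙ 0ℙ = refl
  flips-cancel 0ℙ 1ℙ = refl
  flips-cancel 1ℙ 0ℙ = refl
  flips-cancel 1ℙ 1ℙ = refl

relParity-↭ : ∀ {g : Fin m → Fin m} → Injective _≡_ _≡_ g → ∀ {xs ys} → Unique xs → xs ↭ ys →
              relParity g xs ≡ relParity g ys
relParity-↭ g-inj u ↭-refl = refl
relParity-↭ g-inj (_ ∷ u) (prep x p) = relParity-∷ _ x p (relParity-↭ g-inj u p)
relParity-↭ g-inj {xs = _ ∷ _ ∷ xs} ((x≢y ∷ _) ∷ _ ∷ u) (swap x y p) =
  trans (relParity-swap g-inj xs x≢y) (relParity-∷ _ y (prep x p) (relParity-∷ _ x p (relParity-↭ g-inj u p)))
relParity-↭ g-inj u (↭-trans p q) = trans (relParity-↭ g-inj u p) (relParity-↭ g-inj (Unique-resp-↭ p u) q)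

invParity-map : ∀ {g : Fin m → Fin m} → Injective _≡_ _≡_ g → ∀ {xs} → Unique xs → xs ↭ allFin m →
                invParity (map g xs) ≡ invParity xs + invParity (tabulate g)
invParity-map {m} {g} g-inj {xs} u p = p+q≡r⇒q≡p+r {invParity xs} (begin
  invParity xs + invParity (map g xs)                   ≡⟨ ℙ.+-comm (invParity xs) _ ⟩
  relParity g xs                                        ≡⟨ relParity-↭ g-inj u p ⟩
  invParity (map g (allFin m)) + invParity (allFin m)   ≡⟨ cong₂ _+_ (cong invParity (List.map-tabulate id g))
                                                                      (invParity-allFin m) ⟩
  invParity (tabulate g) + 0ℙ                           ≡⟨ ℙ.+-identityʳ _ ⟩
  invParity (tabulate g)                                ∎)
  where open ≡-Reasoning

entries : Perm m → List (Fin m)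
entries π = tabulate (π ⟨$⟩ʳ_)

module _ (π : Perm m) where

  ⟨$⟩ʳ-injective : Injective _≡_ _≡_ (π ⟨$⟩ʳ_)
  ⟨$⟩ʳ-injective = Injection.injective (↔⇒↣ π)

  entries-unique : Unique (entries π)
  entries-unique = Unique.tabulate⁺ ⟨$⟩ʳ-injective

  entries-complete : ∀ x → x ∈ entries π
  entries-complete x = subst (_∈ entries π) (inverseʳ π) (∈-tabulate⁺ (π ⟨$⟩ˡ x))

  entries-↭ : entries π ↭ allFin m
  entries-↭ = unique-complete⇒↭ entries-unique (Unique.allFin⁺ m) entries-complete ∈-allFin

invParity-entries-flip : ∀ (π : Perm m) → invParity (entries (flip π)) ≡ invParity (entries π)
invParity-entries-flip {m} π = Equivalence.to (+≡0ℙ⇔≡ _ _) (sym (begin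
  0ℙ                                           ≡⟨ sym (invParity-allFin m) ⟩
  invParity (allFin m)                         ≡⟨ cong invParity (sym (trans (List.map-tabulate (π ⟨$⟩ˡ_) (π ⟨$⟩ʳ_))
                                                                              (List.tabulate-cong (λ _ → inverseʳ π)))) ⟩
  invParity (map (π ⟨$⟩ʳ_) (entries (flip π))) ≡⟨ invParity-map (⟨$⟩ʳ-injective π) (entries-unique (flip π)) (entries-↭ (flip π)) ⟩
  invParity (entries (flip π)) + invParity (entries π) ∎))
  where open ≡-Reasoning

invParity-relative : ∀ (o o′ : Perm m) →
                     invParity (entries (o′ ∘ₚ flip o)) ≡ invParity (entries o′) + invParity (entries o)
invParity-relative o o′ = begin
  invParity (entries (o′ ∘ₚ flip o))            ≡⟨ cong invParity (sym (List.map-tabulate (o′ ⟨$⟩ʳ_) (o ⟨$⟩ˡ_))) ⟩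
  invParity (map (o ⟨$⟩ˡ_) (entries o′))         ≡⟨ invParity-map (⟨$⟩ʳ-injective (flip o)) (entries-unique o′) (entries-↭ o′) ⟩
  invParity (entries o′) + invParity (entries (flip o)) ≡⟨ cong (invParity (entries o′) +_) (invParity-entries-flip o) ⟩
  invParity (entries o′) + invParity (entries o) ∎
  where open ≡-Reasoning

sameOrientation⇔ : ∀ (o o′ : Ordering m) → SameOrientation o o′ ⇔ invParity (entries o) ≡ invParity (entries o′)
sameOrientation⇔ o o′ = mk⇔
  (λ even → sym (Equivalence.to (+≡0ℙ⇔≡ _ _) (trans (sym parity≡) (Equivalence.to (2∣⇔parity≡0ℙ _) even))))
  (λ same → Equivalence.from (2∣⇔parity≡0ℙ _) (trans parity≡ (Equivalence.from (+≡0ℙ⇔≡ _ _) (sym same))))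
  where
  parity≡ : parity (inversions ((o′ ∘ₚ flip o) ⟨$⟩ʳ_)) ≡ invParity (entries o′) + invParity (entries o)
  parity≡ = trans (parity-inversions ((o′ ∘ₚ flip o) ⟨$⟩ʳ_)) (invParity-relative o o′)

-- Cycles of a function, as lists

module _ {A : Set} where

  Maps : (A → A) → A → A → Set
  Maps f x y = f x ≡ y

  IsCycle : (A → A) → List A → Set
  IsCycle f []       = ⊥
  IsCycle f (x ∷ xs) = Linked (Maps f) (x ∷ xs ++ [ x ])

  Linked-snoc : ∀ {R : A → A → Set} xs {y z} → Linked R (xs ++ [ y ]) → R y z → Linked R (xs ++ y ∷ [ z ])
  Linked-snoc []           _       r = r ∷ [-]
  Linked-snoc (_ ∷ [])     (r′ ∷ _) r = r′ ∷ r ∷ [-]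
  Linked-snoc (_ ∷ w ∷ xs) (r′ ∷ l) r = r′ ∷ Linked-snoc (w ∷ xs) l r

  IsCycle-cong : ∀ {f g : A → A} → (∀ x → f x ≡ g x) → ∀ xs → IsCycle f xs → IsCycle g xs
  IsCycle-cong f≗g (x ∷ xs) = Linked.map (λ {y} fy≡z → trans (sym (f≗g y)) fy≡z)

  IsCycle-rotate₁ : ∀ {f} x xs → IsCycle f (x ∷ xs) → IsCycle f (xs ++ [ x ])
  IsCycle-rotate₁ x []       c       = c
  IsCycle-rotate₁ x (w ∷ ws) (x↦w ∷ l) =
    subst (Linked (Maps _)) (sym (List.++-assoc (w ∷ ws) [ x ] [ w ])) (Linked-snoc (w ∷ ws) l x↦w)

  IsCycle-rotate : ∀ {f} xs y ys → IsCycle f (xs ++ y ∷ ys) → IsCycle f (y ∷ ys ++ xs)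
  IsCycle-rotate []       y ys c = subst (λ zs → IsCycle _ (y ∷ zs)) (sym (List.++-identityʳ ys)) c
  IsCycle-rotate (x ∷ xs) y ys c =
    subst (λ zs → IsCycle _ (y ∷ zs)) (List.++-assoc ys [ x ] xs)
      (IsCycle-rotate xs y (ys ++ [ x ])
        (subst (IsCycle _) (List.++-assoc xs (y ∷ ys) [ x ]) (IsCycle-rotate₁ x (xs ++ y ∷ ys) c)))

  Linked-determined : ∀ {f x w} xs ys → Linked (Maps f) (x ∷ xs ++ [ w ]) → Linked (Maps f) (x ∷ ys ++ [ w ]) →
                      w ∉ xs → w ∉ ys → xs ≡ ys
  Linked-determined []       []       _         _         _    _    = refl
  Linked-determined []       (y ∷ ys) (x↦w ∷ _) (x↦y ∷ _) _    w∉ys = contradiction (here (trans (sym x↦w) x↦y)) w∉ys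
  Linked-determined (y ∷ xs) []       (x↦y ∷ _) (x↦w ∷ _) w∉xs _    = contradiction (here (trans (sym x↦w) x↦y)) w∉xs
  Linked-determined (y ∷ xs) (y′ ∷ ys) (refl ∷ l) (x↦y′ ∷ l′) w∉xs w∉ys with x↦y′
  ... | refl = cong (y ∷_) (Linked-determined xs ys l l′ (w∉xs ∘ there) (w∉ys ∘ there))

  IsCycle-determined : ∀ {f x xs ys} → IsCycle f (x ∷ xs) → IsCycle f (x ∷ ys) → x ∉ xs → x ∉ ys → xs ≡ ys
  IsCycle-determined {xs = xs} {ys} = Linked-determined xs ys

  IsCycle-splice : ∀ {f g : A → A} {x b c zs} → IsCycle g (x ∷ zs) →
                   f x ≡ b → f b ≡ c → f c ≡ g x → (∀ z → z ∈ zs → f z ≡ g z) → IsCycle f (x ∷ b ∷ c ∷ zs)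
  IsCycle-splice {f = f} {g} {zs = zs} c x↦b b↦c c↦gx agree = x↦b ∷ b↦c ∷ retarget zs c c↦gx agree
    where
    retarget : ∀ zs {x y t} → Linked (Maps g) (y ∷ zs ++ [ t ]) → f x ≡ g y →
               (∀ z → z ∈ zs → f z ≡ g z) → Linked (Maps f) (x ∷ zs ++ [ t ])
    retarget []       (r ∷ [-]) e _     = trans e r ∷ [-]
    retarget (z ∷ zs) (r ∷ l)   e agree = trans e r ∷ retarget zs l (agree z (here refl)) (λ z z∈zs → agree z (there z∈zs))

IsCycle-invParity : ∀ {m} {f : Fin m → Fin m} {ws x xs} → IsCycle f ws → IsCycle f (x ∷ xs) →
                    Unique ws → Unique (x ∷ xs) → x ∈ ws → parity (length ws) ≡ 1ℙ →
                    invParity (x ∷ xs) ≡ invParity ws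
IsCycle-invParity {x = x} {xs} c c′ u u′ x∈ws odd with ∈-∃++ x∈ws
... | pre , suf , refl = begin
  invParity (x ∷ xs)            ≡⟨ cong (λ zs → invParity (x ∷ zs)) xs≡suf++pre ⟩
  invParity (x ∷ suf ++ pre)    ≡⟨ invParity-rotate pre (x ∷ suf) u odd ⟩
  invParity (pre ++ x ∷ suf)    ∎
  where
  open ≡-Reasoning
  xs≡suf++pre : xs ≡ suf ++ pre
  xs≡suf++pre = IsCycle-determined c′ (IsCycle-rotate pre x suf c) (Unique.Unique[x∷xs]⇒x∉xs u′)
    (Unique.Unique[x∷xs]⇒x∉xs (Unique-resp-↭ (↭.++-comm pre (x ∷ suf)) u))

record CycleThrough (f : Fin m → Fin m) (vs : List (Fin m)) : Set where
  field
    cycle      : List (Fin m)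
    isCycle    : IsCycle f cycle
    ↭vertices  : cycle ↭ vs
    invParity≡ : invParity cycle ≡ invParity vs
    fixesRest  : ∀ x → x ∉ cycle → f x ≡ x

CycleThrough-cong : ∀ {f g : Fin m → Fin m} {vs} → (∀ x → f x ≡ g x) → CycleThrough f vs → CycleThrough g vs
CycleThrough-cong f≗g C = record
  { CycleThrough C
  ; isCycle   = IsCycle-cong f≗g cycle isCycle
  ; fixesRest = λ x x∉ → trans (sym (f≗g x)) (fixesRest x x∉)
  }
  where open CycleThrough C

CycleThrough-invParity : ∀ {f : Fin m → Fin m} {vs x xs} → Unique vs → parity (length vs) ≡ 1ℙ → CycleThrough f vs →
                         IsCycle f (x ∷ xs) → Unique (x ∷ xs) → x ∈ vs → invParity (x ∷ xs) ≡ invParity vs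
CycleThrough-invParity u odd C cyc u′ x∈ = trans
  (IsCycle-invParity isCycle cyc (Unique-resp-↭ (↭-sym ↭vertices) u) u′ (↭.∈-resp-↭ (↭-sym ↭vertices) x∈)
    (trans (cong parity (↭.↭-length ↭vertices)) odd))
  invParity≡
  where open CycleThrough C

CycleThrough-splice : ∀ {f g : Fin m → Fin m} {vs a b c} → Unique vs → parity (length vs) ≡ 1ℙ →
                      CycleThrough g vs → a ∈ vs → b ∉ vs → c ∉ vs → f a ≡ b → f b ≡ c → f c ≡ g a →
                      (∀ z → z ≢ a → z ≢ b → z ≢ c → f z ≡ g z) → CycleThrough f (vs ++ b ∷ c ∷ [])
CycleThrough-splice {vs = vs} {a} {b} {c} u odd
  record { cycle = ws ; isCycle = cyc ; ↭vertices = ws↭vs ; invParity≡ = ws-parity ; fixesRest = ws-fixes }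
  a∈ b∉ c∉ a↦b b↦c c↦ga agree with ∈-∃++ (↭.∈-resp-↭ (↭-sym ws↭vs) a∈)
... | pre , suf , refl = record
  { cycle      = a ∷ b ∷ c ∷ zs
  ; isCycle    = IsCycle-splice (IsCycle-rotate pre a suf cyc) a↦b b↦c c↦ga
                   (λ z z∈ → agree z (λ { refl → a∉zs z∈ }) (λ { refl → b∉ (zs⊆vs z∈) }) (λ { refl → c∉ (zs⊆vs z∈) }))
  ; ↭vertices  = ↭-trans (prep a (↭.++-comm (b ∷ c ∷ []) zs)) (↭.++⁺ʳ (b ∷ c ∷ []) a∷zs↭vs)
  ; invParity≡ = begin
      below a (b ∷ c ∷ zs) + invParity (b ∷ c ∷ zs)
        ≡⟨ cong₂ _+_ (Σℙ-↭ _ (↭.++-comm (b ∷ c ∷ []) zs)) (invParity-moveBlock zs (b∉ ∘ zs⊆vs) (c∉ ∘ zs⊆vs)) ⟩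
      invParity ((a ∷ zs) ++ b ∷ c ∷ [])
        ≡⟨ invParity-++-↭ {p = 0ℙ} (b ∷ c ∷ []) a∷zs↭vs (trans rotation-invariant ws-parity) ⟩
      invParity (vs ++ b ∷ c ∷ []) ∎
  ; fixesRest  = λ x x∉ → trans (agree x (x∉ ∘ here) (x∉ ∘ there ∘ here) (x∉ ∘ there ∘ there ∘ here))
                                (ws-fixes x (outside x∉))
  }
  where
  open ≡-Reasoning
  zs = suf ++ pre
  a∷zs↭vs : a ∷ zs ↭ vs
  a∷zs↭vs = ↭-trans (↭.++-comm (a ∷ suf) pre) ws↭vs
  a∉zs : a ∉ zs
  a∉zs = Unique.Unique[x∷xs]⇒x∉xs (Unique-resp-↭ (↭-sym a∷zs↭vs) u)
  zs⊆vs : ∀ {z} → z ∈ zs → z ∈ vs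
  zs⊆vs z∈ = ↭.∈-resp-↭ a∷zs↭vs (there z∈)
  rotation-invariant : invParity (a ∷ zs) ≡ invParity (pre ++ a ∷ suf)
  rotation-invariant = invParity-rotate pre (a ∷ suf) (Unique-resp-↭ (↭-sym ws↭vs) u)
                         (trans (cong parity (↭.↭-length ws↭vs)) odd)
  outside : ∀ {x} → x ∉ a ∷ b ∷ c ∷ zs → x ∉ pre ++ a ∷ suf
  outside x∉ x∈ with ↭.∈-resp-↭ (↭.++-comm pre (a ∷ suf)) x∈
  ... | here x≡a   = x∉ (here x≡a)
  ... | there x∈zs = x∉ (there (there (there x∈zs)))

module _ {A : Set} {R : A → A → Set} where

  Consecutive : ∀ {n} → (Fin n → A) → Set
  Consecutive f = ∀ i j → suc (toℕ i) ≡ toℕ j → R (f i) (f j)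

  Linked-tabulate⁺ : ∀ k (f : Fin (suc k) → A) {z} → Consecutive f → R (f (fromℕ k)) z →
                     Linked R (tabulate f ++ [ z ])
  Linked-tabulate⁺ zero    f cons last = last ∷ [-]
  Linked-tabulate⁺ (suc k) f cons last =
    cons zero (suc zero) refl ∷ Linked-tabulate⁺ k (f ∘ suc) (λ i j eq → cons (suc i) (suc j) (cong suc eq)) last

  Linked-tabulate⁻ : ∀ k (f : Fin (suc k) → A) {z} → Linked R (tabulate f ++ [ z ]) →
                     Consecutive f × R (f (fromℕ k)) z
  Linked-tabulate⁻ zero    f (last ∷ [-]) = (λ { zero zero () }) , last
  Linked-tabulate⁻ (suc k) f (r ∷ l) with Linked-tabulate⁻ k (f ∘ suc) l
  ... | cons , last = extend , last
    where
    extend : Consecutive f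
    extend zero    (suc zero)    _  = r
    extend (suc i) (suc j)       eq = cons i j (ℕ.suc-injective eq)
    extend zero    zero          ()
    extend zero    (suc (suc j)) ()
    extend (suc i) zero          ()

CycleOrdering⇔IsCycle : ∀ {k} (c : Perm (suc k)) (o : Ordering (suc k)) →
                        CycleOrdering c o ⇔ IsCycle (c ⟨$⟩ʳ_) (entries o)
CycleOrdering⇔IsCycle {k} c o = mk⇔ to from
  where
  to : CycleOrdering c o → IsCycle (c ⟨$⟩ʳ_) (entries o)
  to co = Linked-tabulate⁺ k (o ⟨$⟩ʳ_) (λ i j eq → co i j (inj₁ eq))
                            (co (fromℕ k) zero (inj₂ (cong suc (Fin.toℕ-fromℕ k) , refl)))
  from : IsCycle (c ⟨$⟩ʳ_) (entries o) → CycleOrdering c o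
  from cyc i j (inj₁ eq) = proj₁ (Linked-tabulate⁻ k (o ⟨$⟩ʳ_) cyc) i j eq
  from cyc i zero (inj₂ (eq , _))
    with Fin.toℕ-injective {i = i} {fromℕ k} (trans (ℕ.suc-injective eq) (sym (Fin.toℕ-fromℕ k)))
  ... | refl = proj₂ (Linked-tabulate⁻ k (o ⟨$⟩ʳ_) cyc)

fromEntries : ∀ {m} (ws : List (Fin m)) → Unique ws → (∀ x → x ∈ ws) → length ws ≡ m →
              ∃ λ (o : Ordering m) → entries o ≡ ws
fromEntries {m} ws u complete len≡m = permutation to from to∘from from∘to , entries≡ws
  where
  to : Fin m → Fin m
  to i = lookup ws (cast (sym len≡m) i)
  from : Fin m → Fin m
  from x = cast len≡m (index (complete x))
  to∘from : ∀ x → to (from x) ≡ x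
  to∘from x = trans (cong (lookup ws) (Fin.cast-involutive (sym len≡m) len≡m _)) (sym (lookup-index (complete x)))
  from∘to : ∀ i → from (to i) ≡ i
  from∘to i = trans (cong (cast len≡m) (lookup-injective u _ _ (sym (lookup-index (complete (to i))))))
                    (Fin.cast-involutive len≡m (sym len≡m) i)
  entries≡ws : tabulate to ≡ ws
  entries≡ws = tabulate-lookup-cast len≡m
    where
    tabulate-lookup-cast : ∀ {m} (eq : length ws ≡ m) → tabulate (λ i → lookup ws (cast (sym eq) i)) ≡ ws
    tabulate-lookup-cast refl =
      trans (List.tabulate-cong (λ i → cong (lookup ws) (Fin.cast-is-id refl i))) (List.tabulate-lookup ws)

record Is3Cycle (π : Perm m) (a b c : Fin m) : Set where
  field
    a↦b   : π ⟨$⟩ʳ a ≡ b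
    b↦c   : π ⟨$⟩ʳ b ≡ c
    c↦a   : π ⟨$⟩ʳ c ≡ a
    fixes : ∀ x → x ≢ a → x ≢ b → x ≢ c → π ⟨$⟩ʳ x ≡ x

record IsTriple (s : Subset m) (a b c : Fin m) : Set where
  field
    a≢b : a ≢ b
    b≢c : b ≢ c
    a≢c : a ≢ c
    a∈  : a ∈ₛ s
    b∈  : b ∈ₛ s
    c∈  : c ∈ₛ s
    only : ∀ x → x ∈ₛ s → x ≡ a ⊎ x ≡ b ⊎ x ≡ c

Is3Cycle-rotate : ∀ {π : Perm m} {a b c} → Is3Cycle π a b c → Is3Cycle π b c a
Is3Cycle-rotate τ = record
  { a↦b = b↦c ; b↦c = c↦a ; c↦a = a↦b ; fixes = λ x x≢b x≢c x≢a → fixes x x≢a x≢b x≢c }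
  where open Is3Cycle τ

Is3Cycle-flip : ∀ {π : Perm m} {a b c} → Is3Cycle π a b c → Is3Cycle (flip π) a c b
Is3Cycle-flip {π = π} τ = record
  { a↦b = back c↦a ; b↦c = back b↦c ; c↦a = back a↦b
  ; fixes = λ x x≢a x≢c x≢b → back (fixes x x≢a x≢b x≢c) }
  where
  open Is3Cycle τ
  back : ∀ {x y} → π ⟨$⟩ʳ x ≡ y → π ⟨$⟩ˡ y ≡ x
  back refl = inverseˡ π

IsTriple-rotate : ∀ {s : Subset m} {a b c} → IsTriple s a b c → IsTriple s b c a
IsTriple-rotate t = record
  { a≢b = b≢c ; b≢c = a≢c ∘ sym ; a≢c = a≢b ∘ sym ; a∈ = b∈ ; b∈ = c∈ ; c∈ = a∈
  ; only = λ x x∈ → [ inj₂ ∘ inj₂ , [ inj₁ , inj₂ ∘ inj₁ ]′ ]′ (only x x∈) }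
  where open IsTriple t

IsTriple-swap : ∀ {s : Subset m} {a b c} → IsTriple s a b c → IsTriple s a c b
IsTriple-swap t = record
  { a≢b = a≢c ; b≢c = b≢c ∘ sym ; a≢c = a≢b ; a∈ = a∈ ; b∈ = c∈ ; c∈ = b∈
  ; only = λ x x∈ → [ inj₁ , [ inj₂ ∘ inj₂ , inj₂ ∘ inj₁ ]′ ]′ (only x x∈) }
  where open IsTriple t

length≤∣∣ : ∀ (s : Subset m) {xs} → Unique xs → All (_∈ₛ s) xs → length xs ≤ ∣ s ∣
length≤∣∣ s []         []           = z≤n
length≤∣∣ s (x∉ ∷ u) (x∈ ∷ xs∈) =
  ℕ.≤-trans (s≤s (length≤∣∣ _ u (All.zipWith (λ (x≢y , y∈) → x∈p∧x≢y⇒x∈p-y y∈ (x≢y ∘ sym)) (x∉ , xs∈))))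
            (x∈p⇒∣p-x∣<∣p∣ x∈)

IsThreeCycleOn⇒IsTriple : ∀ {s : Subset m} {π} → ∣ s ∣ ≡ 3 → IsThreeCycleOn s π →
                          ∃ λ a → ∃ λ b → ∃ λ c → Is3Cycle π a b c × IsTriple s a b c
IsThreeCycleOn⇒IsTriple {s = s} ∣s∣≡3 (a , b , c , a≢b , b≢c , a≢c , a∈ , b∈ , c∈ , a↦b , b↦c , c↦a , fixes) =
  a , b , c ,
  record { a↦b = a↦b ; b↦c = b↦c ; c↦a = c↦a
         ; fixes = λ x x≢a x≢b x≢c → fixes x (λ x∈ → [ x≢a , [ x≢b , x≢c ]′ ]′ (only x x∈)) } ,
  record { a≢b = a≢b ; b≢c = b≢c ; a≢c = a≢c ; a∈ = a∈ ; b∈ = b∈ ; c∈ = c∈ ; only = only }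
  where
  only : ∀ x → x ∈ₛ s → x ≡ a ⊎ x ≡ b ⊎ x ≡ c
  only x x∈ with x ≟ a | x ≟ b | x ≟ c
  ... | yes x≡a | _       | _       = inj₁ x≡a
  ... | no _    | yes x≡b | _       = inj₂ (inj₁ x≡b)
  ... | no _    | no _    | yes x≡c = inj₂ (inj₂ x≡c)
  ... | no x≢a  | no x≢b  | no x≢c  = contradiction
    (subst (4 ≤_) ∣s∣≡3 (length≤∣∣ s ((x≢a ∷ x≢b ∷ x≢c ∷ []) ∷ (a≢b ∷ a≢c ∷ []) ∷ (b≢c ∷ []) ∷ [] ∷ [])
                                      (x∈ ∷ a∈ ∷ b∈ ∷ c∈ ∷ [])))
    (ℕ.<-irrefl refl)

prod-++ : ∀ (πs ρs : List (Perm m)) x → prod (πs ++ ρs) ⟨$⟩ʳ x ≡ prod πs ⟨$⟩ʳ (prod ρs ⟨$⟩ʳ x)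
prod-++ []       ρs x = refl
prod-++ (π ∷ πs) ρs x = cong (π ⟨$⟩ʳ_) (prod-++ πs ρs x)

prod-fixes : ∀ (πs : List (Perm m)) {x} → All (λ π → π ⟨$⟩ʳ x ≡ x) πs → prod πs ⟨$⟩ʳ x ≡ x
prod-fixes []       []            = refl
prod-fixes (π ∷ πs) (π-x ∷ πs-x) = trans (cong (π ⟨$⟩ʳ_) (prod-fixes πs πs-x)) π-x

-- Inserting the 3-cycle (a b c) into a product X Y whose factors fix b and c
-- splices b, c into the cycle of X Y right after Y⁻¹ a.
module Splice {X Y τ : Perm m} {a b c : Fin m} (τ-abc : Is3Cycle τ a b c)
              (X-b : X ⟨$⟩ʳ b ≡ b) (X-c : X ⟨$⟩ʳ c ≡ c) (Y-b : Y ⟨$⟩ʳ b ≡ b) (Y-c : Y ⟨$⟩ʳ c ≡ c) where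

  open Is3Cycle τ-abc

  a′ : Fin m
  a′ = Y ⟨$⟩ˡ a

  with-τ without-τ : Fin m → Fin m
  with-τ    x = X ⟨$⟩ʳ (τ ⟨$⟩ʳ (Y ⟨$⟩ʳ x))
  without-τ x = X ⟨$⟩ʳ (Y ⟨$⟩ʳ x)

  with-τ-a′ : with-τ a′ ≡ b
  with-τ-a′ = trans (cong (λ y → X ⟨$⟩ʳ (τ ⟨$⟩ʳ y)) (inverseʳ Y)) (trans (cong (X ⟨$⟩ʳ_) a↦b) X-b)

  with-τ-b : with-τ b ≡ c
  with-τ-b = trans (cong (λ y → X ⟨$⟩ʳ (τ ⟨$⟩ʳ y)) Y-b) (trans (cong (X ⟨$⟩ʳ_) b↦c) X-c)

  with-τ-c : with-τ c ≡ without-τ a′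
  with-τ-c = trans (cong (λ y → X ⟨$⟩ʳ (τ ⟨$⟩ʳ y)) Y-c) (trans (cong (X ⟨$⟩ʳ_) c↦a) (cong (X ⟨$⟩ʳ_) (sym (inverseʳ Y))))

  agree : ∀ z → z ≢ a′ → z ≢ b → z ≢ c → with-τ z ≡ without-τ z
  agree z z≢a′ z≢b z≢c = cong (X ⟨$⟩ʳ_) (fixes _ (Y-moves z≢a′) (Y-moves (fixed⇒≢ Y-b z≢b)) (Y-moves (fixed⇒≢ Y-c z≢c)))
    where
    Y-moves : ∀ {z y} → z ≢ Y ⟨$⟩ˡ y → Y ⟨$⟩ʳ z ≢ y
    Y-moves z≢ refl = z≢ (sym (inverseˡ Y))
    fixed⇒≢ : ∀ {x} → Y ⟨$⟩ʳ x ≡ x → z ≢ x → z ≢ Y ⟨$⟩ˡ x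
    fixed⇒≢ Y-x z≢x z≡ = z≢x (trans z≡ (trans (cong (Y ⟨$⟩ˡ_) (sym Y-x)) (inverseˡ Y)))

-- Shellings of a tree

module _ {m n} (T : ThreeGraph m n) (σ : Fin n → Perm m) where

  -- A shelling builds a subtree edge by edge, listing its vertices as r b₁ c₁ b₂ c₂ … .
  data Shelling : List (Fin n) → List (Fin m) → Set where
    root   : ∀ r → Shelling [] [ r ]
    attach : ∀ {es vs e a b c} → Shelling es vs → e ∉ es → a ∈ vs → b ∉ vs → c ∉ vs →
             Is3Cycle (σ e) a b c → IsTriple (v T e) a b c → Shelling (e ∷ es) (vs ++ b ∷ c ∷ [])

  vertices-unique : ∀ {es vs} → Shelling es vs → Unique vs
  vertices-unique (root r)                 = [] ∷ []
  vertices-unique (attach S _ _ b∉ c∉ _ t) = Unique.++⁺ (vertices-unique S) ((IsTriple.b≢c t ∷ []) ∷ [] ∷ []) new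
    where
    new : ∀ {x} → ¬ (x ∈ _ × x ∈ _ ∷ _ ∷ [])
    new (x∈ , here refl)         = b∉ x∈
    new (x∈ , there (here refl)) = c∉ x∈

  edges-unique : ∀ {es vs} → Shelling es vs → Unique es
  edges-unique (root r)               = []
  edges-unique (attach S e∉ _ _ _ _ _) = All.¬Any⇒All¬ _ e∉ ∷ edges-unique S

  vertices-odd : ∀ {es vs} → Shelling es vs → parity (length vs) ≡ 1ℙ
  vertices-odd (root r)                          = refl
  vertices-odd (attach {vs = vs} S _ _ _ _ _ _) =
    trans (cong parity (List.length-++ vs)) (trans (ℙ.+-homo-+ (length vs) 2) (trans (ℙ.+-identityʳ _) (vertices-odd S)))

  edge-vertices : ∀ {es vs e x} → Shelling es vs → e ∈ es → x ∈ₛ v T e → x ∈ vs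
  edge-vertices (attach {vs = vs} S _ a∈ _ _ _ t) (here refl) x∈ =
    [ (λ { refl → ∈-++⁺ˡ a∈ }) , [ (λ { refl → ∈-++⁺ʳ vs (here refl) }) , (λ { refl → ∈-++⁺ʳ vs (there (here refl)) }) ]′ ]′
      (IsTriple.only t _ x∈)
  edge-vertices (attach S _ _ _ _ _ _) (there e∈) x∈ = ∈-++⁺ˡ (edge-vertices S e∈ x∈)

  fixes-outside : ∀ {es vs e x} → Shelling es vs → e ∈ es → x ∉ vs → σ e ⟨$⟩ʳ x ≡ x
  fixes-outside (attach {vs = vs} S _ a∈ _ _ τ _) (here refl) x∉ = Is3Cycle.fixes τ _
    (λ { refl → x∉ (∈-++⁺ˡ a∈) }) (λ { refl → x∉ (∈-++⁺ʳ vs (here refl)) })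
    (λ { refl → x∉ (∈-++⁺ʳ vs (there (here refl))) })
  fixes-outside (attach S _ _ _ _ _ _) (there e∈) x∉ = fixes-outside S e∈ (x∉ ∘ ∈-++⁺ˡ)

  product : List (Fin n) → Fin m → Fin m
  product ls x = prod (map σ ls) ⟨$⟩ʳ x

  product-++ : ∀ ls ks x → product (ls ++ ks) x ≡ prod (map σ ls) ⟨$⟩ʳ (prod (map σ ks) ⟨$⟩ʳ x)
  product-++ ls ks x = trans (cong (λ πs → prod πs ⟨$⟩ʳ x) (List.map-++ σ ls ks)) (prod-++ (map σ ls) (map σ ks) x)

  product-fixes : ∀ {es vs} → Shelling es vs → ∀ ls → All (_∈ es) ls → ∀ {x} → x ∉ vs → prod (map σ ls) ⟨$⟩ʳ x ≡ x
  product-fixes S ls ls⊆es x∉ = prod-fixes (map σ ls) (All.map⁺ (All.map (λ e∈ → fixes-outside S e∈ x∉) ls⊆es))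

  attach-cycle : ∀ {es vs e a b c} → Shelling es vs → a ∈ vs → b ∉ vs → c ∉ vs → Is3Cycle (σ e) a b c →
                 ∀ ls ks → ls ++ ks ↭ es → CycleThrough (product (ls ++ ks)) vs →
                 CycleThrough (product (ls ++ e ∷ ks)) (vs ++ b ∷ c ∷ [])
  attach-cycle {es} {vs} {e} {a} S a∈ b∉ c∉ τ ls ks p C =
    CycleThrough-cong (λ x → sym (product-++ ls (e ∷ ks) x))
      (CycleThrough-splice (vertices-unique S) (vertices-odd S) (CycleThrough-cong (product-++ ls ks) C)
         a′∈ b∉ c∉ with-τ-a′ with-τ-b with-τ-c agree)
    where
    ls++ks⊆es : All (_∈ es) (ls ++ ks)
    ls++ks⊆es = All.tabulate (↭.∈-resp-↭ p)
    fixes-ls = product-fixes S ls (All.++⁻ˡ ls ls++ks⊆es)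
    fixes-ks = product-fixes S ks (All.++⁻ʳ ls ls++ks⊆es)
    open Splice {X = prod (map σ ls)} {Y = prod (map σ ks)} τ (fixes-ls b∉) (fixes-ls c∉) (fixes-ks b∉) (fixes-ks c∉)
    a′∈ : a′ ∈ vs
    a′∈ with DecMembership._∈?_ _≟_ a′ vs
    ... | yes a′∈ = a′∈
    ... | no  a′∉ = contradiction (subst (_∈ vs) (trans (sym (inverseʳ (prod (map σ ks)))) (fixes-ks a′∉)) a∈) a′∉

  product-cycle : ∀ {es vs} → Shelling es vs → ∀ ls → ls ↭ es → CycleThrough (product ls) vs
  product-cycle (root r) ls p with ↭.↭-empty-inv p
  ... | refl = record { cycle = [ r ] ; isCycle = refl ∷ [-] ; ↭vertices = ↭-refl
                      ; invParity≡ = refl ; fixesRest = λ _ _ → refl }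
  product-cycle (attach S _ a∈ b∉ c∉ τ _) ls p with ∈-∃++ (↭.∈-resp-↭ (↭-sym p) (here refl))
  ... | ls₁ , ls₂ , refl = attach-cycle S a∈ b∉ c∉ τ ls₁ ls₂ p′ (product-cycle S (ls₁ ++ ls₂) p′)
    where p′ = ↭.drop-mid ls₁ [] p

-- Reversing the orientation of one edge

module _ {m n} (σ : Fin n → Perm m) (e₀ : Fin n) where

  reverseAt-≡ : reverseAt σ e₀ e₀ ≡ flip (σ e₀)
  reverseAt-≡ with e₀ ≟ e₀
  ... | yes _    = refl
  ... | no e₀≢e₀ = contradiction refl e₀≢e₀

  reverseAt-≢ : ∀ {e} → e ≢ e₀ → reverseAt σ e₀ e ≡ σ e
  reverseAt-≢ {e} e≢e₀ with e ≟ e₀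
  ... | yes e≡e₀ = contradiction e≡e₀ e≢e₀
  ... | no _     = refl

module _ {m n} (T : ThreeGraph m n) (σ : Fin n → Perm m) (e₀ : Fin n) where

  private
    σ′ = reverseAt σ e₀

  unreversed : ∀ {es vs} → e₀ ∉ es → Shelling T σ es vs → Shelling T σ′ es vs
  unreversed e₀∉ (root r) = root r
  unreversed e₀∉ (attach S e∉ a∈ b∉ c∉ τ t) =
    attach (unreversed (e₀∉ ∘ there) S) e∉ a∈ b∉ c∉
           (subst (λ π → Is3Cycle π _ _ _) (sym (reverseAt-≢ σ e₀ (λ { refl → e₀∉ (here refl) }))) τ) t

  reversed : ∀ {es vs} → e₀ ∈ es → Shelling T σ es vs →
             ∃ λ vs′ → Shelling T σ′ es vs′ × vs′ ↭ vs × invParity vs′ ≡ 1ℙ + invParity vs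
  reversed (here refl) (attach {vs = vs} {b = b} {c} S e∉ a∈ b∉ c∉ τ t) =
    vs ++ c ∷ b ∷ [] ,
    attach (unreversed e∉ S) e∉ a∈ c∉ b∉ (subst (λ π → Is3Cycle π _ _ _) (sym (reverseAt-≡ σ e₀)) (Is3Cycle-flip τ))
           (IsTriple-swap t) ,
    ↭.++⁺ˡ vs (swap c b ↭-refl) ,
    invParity-swap-last vs (IsTriple.b≢c t)
  reversed (there e₀∈) (attach {b = b} {c} S e∉ a∈ b∉ c∉ τ t) with reversed e₀∈ S
  ... | vs′ , S′ , vs′↭vs , flipped =
    vs′ ++ b ∷ c ∷ [] ,
    attach S′ e∉ (↭.∈-resp-↭ (↭-sym vs′↭vs) a∈) (b∉ ∘ ↭.∈-resp-↭ vs′↭vs) (c∉ ∘ ↭.∈-resp-↭ vs′↭vs)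
           (subst (λ π → Is3Cycle π _ _ _) (sym (reverseAt-≢ σ e₀ (λ { refl → e∉ e₀∈ }))) τ) t ,
    ↭.++⁺ʳ (b ∷ c ∷ []) vs′↭vs ,
    invParity-++-↭ (b ∷ c ∷ []) vs′↭vs flipped

-- Simple paths, and spanning shellings

module _ {m n} (T : ThreeGraph m n) where

  Inside : List (Fin n) → List (Fin m) → Node m n → Set
  Inside es vs (inj₁ x) = x ∈ vs
  Inside es vs (inj₂ e) = e ∈ es

  inside? : ∀ es vs (p : Node m n) → Dec (Inside es vs p)
  inside? es vs (inj₁ x) = DecMembership._∈?_ _≟_ x vs
  inside? es vs (inj₂ e) = DecMembership._∈?_ _≟_ e es

  Inside-mono : ∀ {es vs e} ys p → Inside es vs p → Inside (e ∷ es) (vs ++ ys) p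
  Inside-mono ys (inj₁ x) x∈ = ∈-++⁺ˡ x∈
  Inside-mono ys (inj₂ f) f∈ = there f∈

  Starts : Fin m → Fin m → List (Node m n) → Set
  Starts u w []      = u ≡ w
  Starts u w (p ∷ _) = p ≡ inj₁ u

  -- The path is nodes ++ [ inj₁ w ]; it starts at u, or is the one-node path when nodes is empty.
  record Path (es : List (Fin n)) (vs : List (Fin m)) (u w : Fin m) : Set where
    field
      nodes  : List (Node m n)
      linked : Linked (Adj T) (nodes ++ [ inj₁ w ])
      unique : Unique (nodes ++ [ inj₁ w ])
      inside : All (Inside es vs) (nodes ++ [ inj₁ w ])
      starts : Starts u w nodes

  module _ {es : List (Fin n)} {vs : List (Fin m)} {e : Fin n} (ys : List (Fin m)) where

    path-trivial : ∀ {u} → u ∈ ys → Path (e ∷ es) (vs ++ ys) u u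
    path-trivial u∈ = record { nodes = [] ; linked = [-] ; unique = [] ∷ [] ; inside = ∈-++⁺ʳ vs u∈ ∷ [] ; starts = refl }

    path-mono : ∀ {u w} → Path es vs u w → Path (e ∷ es) (vs ++ ys) u w
    path-mono P = record { Path P ; inside = All.map (Inside-mono ys _) (Path.inside P) }

    path-edge : ∀ {u w} → u ≢ w → u ∈ ys → w ∈ ys → u ∈ₛ v T e → w ∈ₛ v T e → Path (e ∷ es) (vs ++ ys) u w
    path-edge u≢w u∈ w∈ u∈e w∈e = record
      { nodes  = inj₁ _ ∷ inj₂ e ∷ []
      ; linked = u∈e ∷ w∈e ∷ [-]
      ; unique = ((λ ()) ∷ (u≢w ∘ Sum.inj₁-injective) ∷ []) ∷ ((λ ()) ∷ []) ∷ [] ∷ []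
      ; inside = ∈-++⁺ʳ vs u∈ ∷ here refl ∷ ∈-++⁺ʳ vs w∈ ∷ []
      ; starts = refl
      }

    path-snoc : ∀ {u a w} → Path es vs u a → e ∉ es → w ∉ vs → w ∈ ys → a ∈ₛ v T e → w ∈ₛ v T e →
                Path (e ∷ es) (vs ++ ys) u w
    path-snoc {u} {a} {w} P e∉ w∉ w∈ a∈e w∈e = record
      { nodes  = nodes ++ inj₁ a ∷ [ inj₂ e ]
      ; linked = subst (Linked (Adj T)) reassoc (Linked-snoc (nodes ++ [ inj₁ a ])
                   (subst (Linked (Adj T)) (sym (List.++-assoc nodes [ inj₁ a ] [ inj₂ e ])) (Linked-snoc nodes linked a∈e)) w∈e)
      ; unique = subst Unique reassoc (Unique.++⁺ unique (((λ ()) ∷ []) ∷ [] ∷ []) fresh)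
      ; inside = subst (All (Inside (e ∷ es) (vs ++ ys))) reassoc
                   (All.++⁺ (All.map (Inside-mono ys _) inside) (here refl ∷ ∈-++⁺ʳ vs w∈ ∷ []))
      ; starts = starts′ nodes starts
      }
      where
      open Path P
      reassoc : (nodes ++ [ inj₁ a ]) ++ inj₂ e ∷ [ inj₁ w ] ≡ (nodes ++ inj₁ a ∷ [ inj₂ e ]) ++ [ inj₁ w ]
      reassoc = trans (List.++-assoc nodes [ inj₁ a ] (inj₂ e ∷ [ inj₁ w ]))
                      (sym (List.++-assoc nodes (inj₁ a ∷ [ inj₂ e ]) [ inj₁ w ]))
      fresh : ∀ {p} → ¬ (p ∈ nodes ++ [ inj₁ a ] × p ∈ inj₂ e ∷ [ inj₁ w ])
      fresh (p∈ , here refl)         = e∉ (All.lookup inside p∈)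
      fresh (p∈ , there (here refl)) = w∉ (All.lookup inside p∈)
      starts′ : ∀ ps → Starts u a ps → Starts u w (ps ++ inj₁ a ∷ [ inj₂ e ])
      starts′ []      u≡a = cong inj₁ (sym u≡a)
      starts′ (_ ∷ _) p≡u = p≡u

    path-cons : ∀ {u a w} → Path es vs a w → e ∉ es → u ∉ vs → u ∈ ys → a ∈ₛ v T e → u ∈ₛ v T e →
                Path (e ∷ es) (vs ++ ys) u w
    path-cons {u} {a} {w} P e∉ u∉ u∈ a∈e u∈e = record
      { nodes  = inj₁ u ∷ inj₂ e ∷ nodes
      ; linked = u∈e ∷ linked′ nodes starts linked
      ; unique = All.¬Any⇒All¬ _ u-fresh ∷ All.¬Any⇒All¬ _ (e∉ ∘ All.lookup inside) ∷ unique
      ; inside = ∈-++⁺ʳ vs u∈ ∷ here refl ∷ All.map (Inside-mono ys _) inside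
      ; starts = refl
      }
      where
      open Path P
      linked′ : ∀ ps → Starts a w ps → Linked (Adj T) (ps ++ [ inj₁ w ]) → Linked (Adj T) (inj₂ e ∷ ps ++ [ inj₁ w ])
      linked′ []      refl l = a∈e ∷ [-]
      linked′ (_ ∷ _) refl l = a∈e ∷ l
      u-fresh : inj₁ u ∉ inj₂ e ∷ nodes ++ [ inj₁ w ]
      u-fresh (there p∈) = u∉ (All.lookup inside p∈)

module _ {m n} (T : ThreeGraph m n) (σ : Fin n → Perm m) where

  shelling-path : ∀ {es vs u w} → Shelling T σ es vs → u ∈ vs → w ∈ vs → Path T es vs u w
  shelling-path (root r) (here refl) (here refl) =
    record { nodes = [] ; linked = [-] ; unique = [] ∷ [] ; inside = here refl ∷ [] ; starts = refl }
  shelling-path (attach {es = es} {vs} {e} {b = b} {c} S e∉ a∈ b∉ c∉ _ t) u∈ w∈ = from-parts (∈-++⁻ vs u∈) (∈-++⁻ vs w∈)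
    where
    ys = b ∷ c ∷ []
    new∉ : ∀ {x} → x ∈ ys → x ∉ vs
    new∉ (here refl)         = b∉
    new∉ (there (here refl)) = c∉
    new∈ : ∀ {x} → x ∈ ys → x ∈ₛ v T e
    new∈ (here refl)         = IsTriple.b∈ t
    new∈ (there (here refl)) = IsTriple.c∈ t
    from-parts : ∀ {u w} → u ∈ vs ⊎ u ∈ ys → w ∈ vs ⊎ w ∈ ys → Path T (e ∷ es) (vs ++ ys) u w
    from-parts (inj₁ u∈vs) (inj₁ w∈vs) = path-mono T ys (shelling-path S u∈vs w∈vs)
    from-parts (inj₁ u∈vs) (inj₂ w∈ys) = path-snoc T ys (shelling-path S u∈vs a∈) e∉ (new∉ w∈ys) w∈ys (IsTriple.a∈ t) (new∈ w∈ys)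
    from-parts (inj₂ u∈ys) (inj₁ w∈vs) = path-cons T ys (shelling-path S a∈ w∈vs) e∉ (new∉ u∈ys) u∈ys (IsTriple.a∈ t) (new∈ u∈ys)
    from-parts {u} {w} (inj₂ u∈ys) (inj₂ w∈ys) with u ≟ w
    ... | yes refl = path-trivial T ys u∈ys
    ... | no u≢w   = path-edge T ys u≢w u∈ys w∈ys (new∈ u∈ys) (new∈ w∈ys)

  chord⇒cycle : ∀ {es vs e a b} → Path T es vs a b → e ∉ es → a ≢ b → a ∈ₛ v T e → b ∈ₛ v T e → HasCycle T
  chord⇒cycle record { nodes = [] ; starts = a≡b } _ a≢b _ _ = contradiction a≡b a≢b
  chord⇒cycle {e = e} {a} {b} record { nodes = _ ∷ ps ; linked = linked ; unique = unique ; inside = inside ; starts = refl }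
              e∉ _ a∈e b∈e =
    inj₂ e , inj₁ a ∷ ps ++ [ inj₁ b ] ,
    s≤s (s≤s (subst (1 ≤_) (sym (List.length-++ ps)) (ℕ.m≤n+m 1 (length ps)))) ,
    All.¬Any⇒All¬ _ (e∉ ∘ All.lookup inside) ∷ unique ,
    a∈e ∷ subst (Linked (Adj T)) (sym (List.++-assoc (inj₁ a ∷ ps) [ inj₁ b ] [ inj₂ e ]))
            (Linked-snoc (inj₁ a ∷ ps) linked b∈e)

  no-chord : ¬ HasCycle T → ∀ {es vs e x y} → Shelling T σ es vs → e ∉ es → x ∈ vs → y ∈ vs → x ≢ y →
             x ∈ₛ v T e → y ∈ₛ v T e → ⊥
  no-chord acyclic S e∉ x∈ y∈ x≢y x∈e y∈e = acyclic (chord⇒cycle (shelling-path S x∈ y∈) e∉ x≢y x∈e y∈e)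

  Frontier : List (Fin n) → List (Fin m) → Set
  Frontier es vs = ∃ λ e → e ∉ es × ∃ λ x → x ∈ vs × x ∈ₛ v T e

  -- A walk leaving the subtree must do so from a vertex into a new edge, as old edges have only old vertices.
  frontier : ∀ {es vs p q} → Shelling T σ es vs → Walk T p q → Inside T es vs p → ¬ Inside T es vs q → Frontier es vs
  frontier S here p-in q-out = contradiction p-in q-out
  frontier {es} {vs} S (step {b = p′} adj walk) p-in q-out with inside? T es vs p′
  ... | yes p′-in  = frontier S walk p′-in q-out
  ... | no  p′-out = leave _ _ adj p-in p′-out
    where
    leave : ∀ p p′ → Adj T p p′ → Inside T es vs p → ¬ Inside T es vs p′ → Frontier es vs
    leave (inj₁ x) (inj₂ e) x∈e x∈ e∉ = e , e∉ , x , x∈ , x∈e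
    leave (inj₂ e) (inj₁ x) x∈e e∈ x∉ = contradiction (edge-vertices T σ S e∈ x∈e) x∉

  edges-bounded : ∀ {es vs} → Shelling T σ es vs → length es ≤ n
  edges-bounded {es} S = subst (length es ≤_) (∣⊤∣≡n n) (length≤∣∣ ⊤ (edges-unique T σ S) (All.universal (λ _ → ∈⊤) es))

  module _ (acyclic : ¬ HasCycle T) (oriented : ∀ e → IsThreeCycleOn (v T e) (σ e)) where

    attach-at : ∀ {es vs e a b c} → Shelling T σ es vs → e ∉ es → a ∈ vs →
                Is3Cycle (σ e) a b c → IsTriple (v T e) a b c → Shelling T σ (e ∷ es) (vs ++ b ∷ c ∷ [])
    attach-at S e∉ a∈vs τ t = attach S e∉ a∈vs
      (λ b∈vs → no-chord acyclic S e∉ a∈vs b∈vs a≢b a∈ b∈) (λ c∈vs → no-chord acyclic S e∉ a∈vs c∈vs a≢c a∈ c∈) τ t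
      where open IsTriple t

    attach-frontier : ∀ {es vs} → Shelling T σ es vs → Frontier es vs → ∃ λ e → ∃ λ ys → Shelling T σ (e ∷ es) (vs ++ ys)
    attach-frontier S (e , e∉ , x , x∈ , x∈e) with IsThreeCycleOn⇒IsTriple (v-three T e) (oriented e)
    ... | a , b , c , τ , t with IsTriple.only t x x∈e
    ...   | inj₁ refl        = e , _ , attach-at S e∉ x∈ τ t
    ...   | inj₂ (inj₁ refl) = e , _ , attach-at S e∉ x∈ (Is3Cycle-rotate τ) (IsTriple-rotate t)
    ...   | inj₂ (inj₂ refl) = e , _ , attach-at S e∉ x∈ (Is3Cycle-rotate (Is3Cycle-rotate τ)) (IsTriple-rotate (IsTriple-rotate t))

    module _ (connected : Connected T) where

      grow : ∀ fuel {es vs r} → Shelling T σ es vs → r ∈ vs → n ℕ.< length es ℕ.+ fuel →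
             ∃ λ es′ → ∃ λ vs′ → Shelling T σ es′ vs′ × (∀ e → e ∈ es′) × r ∈ vs′
      grow zero S _ n< = contradiction (edges-bounded S) (ℕ.<⇒≱ (subst (n ℕ.<_) (ℕ.+-identityʳ _) n<))
      grow (suc fuel) {es} {vs} {r} S r∈ n< with Fin.all? (λ e → DecMembership._∈?_ _≟_ e es)
      ... | yes all = es , vs , S , all , r∈
      ... | no ¬all with Fin.¬∀⟶∃¬ n _ (λ e → DecMembership._∈?_ _≟_ e es) ¬all
      ...   | e₀ , e₀∉ with attach-frontier S (frontier S (connected (inj₁ r) (inj₂ e₀)) r∈ e₀∉)
      ...     | _ , _ , S′ = grow fuel S′ (∈-++⁺ˡ r∈) (subst (n ℕ.<_) (ℕ.+-suc (length es) fuel) n<)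

      spanning-shelling : Fin m → ∃ λ es → ∃ λ vs → Shelling T σ es vs × (∀ e → e ∈ es) × (∀ x → x ∈ vs)
      spanning-shelling r with grow (suc n) (root r) (here refl) (ℕ.n<1+n n)
      ... | es , vs , S , all-edges , r∈ = es , vs , S , all-edges , all-vertices
        where
        all-vertices : ∀ x → x ∈ vs
        all-vertices x with DecMembership._∈?_ _≟_ x vs
        ... | yes x∈ = x∈
        ... | no  x∉ with frontier S (connected (inj₁ r) (inj₁ x)) r∈ x∉
        ...   | e , e∉ , _ = contradiction (all-edges e) e∉

productAlong-entries : ∀ {m n} (σ : Fin n → Perm m) (ρ : Perm n) → productAlong σ ρ ≡ prod (map σ (entries ρ))
productAlong-entries σ ρ = cong prod (trans (List.map-tabulate id _) (sym (List.map-tabulate (ρ ⟨$⟩ʳ_) σ)))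

module _ {k n} (T : ThreeGraph (suc k) n) (τ : Fin n → Perm (suc k)) {es vs} (S : Shelling T τ es vs)
         (all-edges : ∀ e → e ∈ es) (all-vertices : ∀ x → x ∈ vs) where

  productAlong-cycle : ∀ ρ → CycleThrough (productAlong τ ρ ⟨$⟩ʳ_) vs
  productAlong-cycle ρ = CycleThrough-cong (λ x → cong (_⟨$⟩ʳ x) (sym (productAlong-entries τ ρ)))
    (product-cycle T τ S (entries ρ)
      (unique-complete⇒↭ (entries-unique ρ) (edges-unique T τ S) (entries-complete ρ) all-edges))

  cycleOrdering-exists : ∀ ρ → ∃ λ o → CycleOrdering (productAlong τ ρ) o
  cycleOrdering-exists ρ =
    o , Equivalence.from (CycleOrdering⇔IsCycle (productAlong τ ρ) o) (subst (IsCycle _) (sym entries≡cycle) isCycle)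
    where
    open CycleThrough (productAlong-cycle ρ)
    vs↭allFin : vs ↭ allFin (suc k)
    vs↭allFin = unique-complete⇒↭ (vertices-unique T τ S) (Unique.allFin⁺ _) all-vertices ∈-allFin
    ordering : ∃ λ o → entries o ≡ cycle
    ordering = fromEntries cycle (Unique-resp-↭ (↭-sym ↭vertices) (vertices-unique T τ S))
                 (λ x → ↭.∈-resp-↭ (↭-sym ↭vertices) (all-vertices x))
                 (trans (↭.↭-length ↭vertices) (trans (↭.↭-length vs↭allFin) (List.length-tabulate id)))
    o = proj₁ ordering
    entries≡cycle = proj₂ ordering

  cycleOrdering-invParity : ∀ ρ o → CycleOrdering (productAlong τ ρ) o → invParity (entries o) ≡ invParity vs
  cycleOrdering-invParity ρ o co = CycleThrough-invParity (vertices-unique T τ S) (vertices-odd T τ S) (productAlong-cycle ρ)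
    (Equivalence.to (CycleOrdering⇔IsCycle (productAlong τ ρ) o) co) (entries-unique o) (all-vertices (o ⟨$⟩ʳ zero))

no-edges : ∀ {n} (T : ThreeGraph 0 n) → Fin n → ⊥
no-edges T e with v T e | v-three T e
... | [] | ()

proposition3p8 : ∀ {m n} (T : ThreeGraph m n) → IsTree T →
    (σ̃ : EdgeOrientation T) →
    let σ = proj₁ σ̃ in
    ((ρ : Perm n) → ∃ λ o → CycleOrdering (productAlong σ ρ) o)
    × ((ρ ρ' : Perm n) (o o' : Ordering m) →
        CycleOrdering (productAlong σ ρ) o → CycleOrdering (productAlong σ ρ') o' →
        SameOrientation o o')
    × ((e : Fin n) (ρ ρ' : Perm n) (o o' : Ordering m) →
        CycleOrdering (productAlong σ ρ) o →
        CycleOrdering (productAlong (reverseAt σ e) ρ') o' →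
        ¬ SameOrientation o o')
proposition3p8 {zero} T _ _ = (λ _ → Permutation.id , λ ()) , (λ _ _ _ _ _ _ → divides 0 refl) , ⊥-elim ∘ no-edges T
proposition3p8 {suc k} T (connected , acyclic) (σ , oriented)
  with spanning-shelling T σ acyclic oriented connected zero
... | es , vs , S , all-edges , all-vertices = cycleOrdering-exists T σ S all-edges all-vertices , same , opposite
  where
  orientation : ∀ ρ o → CycleOrdering (productAlong σ ρ) o → invParity (entries o) ≡ invParity vs
  orientation = cycleOrdering-invParity T σ S all-edges all-vertices

  same : ∀ ρ ρ′ o o′ → CycleOrdering (productAlong σ ρ) o → CycleOrdering (productAlong σ ρ′) o′ → SameOrientation o o′
  same ρ ρ′ o o′ co co′ = Equivalence.from (sameOrientation⇔ o o′) (trans (orientation ρ o co) (sym (orientation ρ′ o′ co′)))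

  opposite : ∀ e ρ ρ′ o o′ → CycleOrdering (productAlong σ ρ) o → CycleOrdering (productAlong (reverseAt σ e) ρ′) o′ →
             ¬ SameOrientation o o′
  opposite e ρ ρ′ o o′ co co′ so with reversed T σ e (all-edges e) S
  ... | vs′ , S′ , vs′↭vs , flipped = ℙ.p≢p⁻¹ (invParity vs) (begin
    invParity vs              ≡⟨ sym (orientation ρ o co) ⟩
    invParity (entries o)     ≡⟨ Equivalence.to (sameOrientation⇔ o o′) so ⟩
    invParity (entries o′)    ≡⟨ cycleOrdering-invParity T (reverseAt σ e) S′ all-edges
                                   (λ x → ↭.∈-resp-↭ (↭-sym vs′↭vs) (all-vertices x)) ρ′ o′ co′ ⟩
    invParity vs′             ≡⟨ flipped ⟩
    1ℙ + invParity vs         ∎)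
    where open ≡-Reasoning
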